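{- Let $G$ be a $2$-connected finite simple graph, $X\subseteq V(G)$ with $\kappa_G(X)\ge 4$, and let $Q$ be a Tutte path of $G$. If $X\not\subseteq V(Q)$, then $X\subseteq V(B)$ for some bridge $B$ of $Q$, and in this case $|V(Q)\cap X|\le 3$.
   Context: A set $S\subset V(G)$ is an $X$-separator of $G$ if at least two components of $G-S$ contain a vertex of $X$; $\kappa_G(X)$ is the maximum integer $\le |X|-1$ such that every $X$-separator of $G$ (if any) has at least $\kappa_G(X)$ vertices. For a subgraph $H$ of a connected graph $G$ and a component $K$ of $G-V(H)$, the (non-trivial) bridge $B$ of $H$ determined by $K$ has vertex set $V(K)\cup N_G(K)$ and edge set $E(K)\cup\{uv\in E(G): u\in V(K), v\in V(H)\}$; its attachments are $T(B)=N_G(K)\subseteq V(H)$ and its inner vertices are $I(B)=V(K)$. A Tutte path of $G$ is a path $P$ of $G$ on at least two vertices such that every (non-trivial) bridge of $P$ has at most three attachments. -}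

module Defs where

open import Data.Nat using (ℕ; _≤_; _∸_)
open import Data.Fin using (Fin)
open import Data.Fin.Subset using (Subset; _∈_; _∉_; ∣_∣)
open import Data.List using (List; length)
open import Data.List.Membership.Propositional using () renaming (_∈_ to _∈ₗ_; _∉_ to _∉ₗ_)
open import Data.List.Relation.Unary.All using (All)
open import Data.List.Relation.Unary.Unique.Propositional using (Unique)
open import Data.List.Relation.Unary.Linked using (Linked)
open import Data.Product using (Σ; ∃; _×_)
open import Data.Sum using (_⊎_)
open import Relation.Nullary using (¬_; Dec)

record Graph (n : ℕ) : Set₁ where
  field
    Adj    : Fin n → Fin n → Set
    sym    : ∀ {u v} → Adj u v → Adj v u
    irrefl : ∀ v → ¬ Adj v v
    adj?   : ∀ u v → Dec (Adj u v)
open Graph public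

module _ {n : ℕ} (G : Graph n) where

  -- Conn S u v : u and v lie in the same component of G - S
  -- (S given as a predicate on vertices; both u and v avoid S).
  data Conn (S : Fin n → Set) : Fin n → Fin n → Set where
    here : ∀ {u} → ¬ S u → Conn S u u
    step : ∀ {u w v} → ¬ S u → Adj G u w → Conn S w v → Conn S u v

  AtMost : ℕ → (Fin n → Set) → Set
  AtMost k P = ∀ (xs : List (Fin n)) → Unique xs → All P xs → length xs ≤ k

  TwoConnected : Set
  TwoConnected = (3 ≤ n) × (∀ (S : Subset n) → ∣ S ∣ ≤ 1 →
                   ∀ u v → u ∉ S → v ∉ S → Conn (_∈ S) u v)

  IsXSeparator : Subset n → Subset n → Set
  IsXSeparator X S = ∃ λ x → ∃ λ y → x ∈ X × y ∈ X × x ∉ S × y ∉ S × ¬ Conn (_∈ S) x y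

  KappaAdmissible : Subset n → ℕ → Set
  KappaAdmissible X k = (k ≤ ∣ X ∣ ∸ 1) × (∀ S → IsXSeparator X S → k ≤ ∣ S ∣)

  IsKappa : Subset n → ℕ → Set
  IsKappa X k = KappaAdmissible X k × (∀ k' → KappaAdmissible X k' → k' ≤ k)

  IsPath : List (Fin n) → Set
  IsPath Q = Unique Q × Linked (Adj G) Q × (2 ≤ length Q)

  -- The (non-trivial) bridge of Q determined by the component K of G - V(Q)
  -- containing the vertex r (r ∉ V(Q)).
  -- Inner vertices: V(K).
  Inner : List (Fin n) → Fin n → Fin n → Set
  Inner Q r v = Conn (_∈ₗ Q) r v

  Attachment : List (Fin n) → Fin n → Fin n → Set
  Attachment Q r v = v ∈ₗ Q × ∃ λ w → Inner Q r w × Adj G v w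

  InBridge : List (Fin n) → Fin n → Fin n → Set
  InBridge Q r v = Inner Q r v ⊎ Attachment Q r v

  IsTuttePath : List (Fin n) → Set
  IsTuttePath Q = IsPath Q × (∀ r → r ∉ₗ Q → AtMost 3 (Attachment Q r))

-- Let Q be a Tutte path and r ∈ X a vertex off Q.  Let K be the component of
-- G - V(Q) containing r, and A ⊆ V(Q) its set of attachments; |A| ≤ 3 since
-- Q is a Tutte path.  Every path of G - A starting in K stays in K (leaving
-- K would require stepping onto Q, i.e. onto A).  Hence if some x ∈ X lay
-- outside the bridge K ∪ A, then A would be an X-separator (separating r
-- from x) with at most 3 < 4 ≤ κ_G(X) vertices, which is impossible.  So X
-- lies in the bridge, and X ∩ V(Q) consists of attachments, whence has at
-- most 3 elements.
--
-- Constructively, A must be an actual Subset, so its defining predicate has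
-- to be decidable.
module Submission where

open import Defs
open import Data.Nat using (ℕ; zero; suc; _+_; _≤_; _<_; s≤s)
open import Data.Nat.Properties using (≤-trans; +-suc; +-monoʳ-≤; <⇒≱; m≤m+n)
open import Data.Fin using (Fin; zero; suc)
open import Data.Fin.Properties using (any?; ¬∀⟶∃¬; suc-injective) renaming (_≟_ to _≟ᶠ_)
open import Data.Fin.Subset using (Subset; _∈_; _∉_; ∣_∣; inside; outside; ⁅_⁆; _∪_; _⊂_)
open import Data.Fin.Subset.Properties
  using (_∈?_; x∈⁅x⁆; x∈⁅y⁆⇒x≡y; x∈p∪q⁻; x∈p∪q⁺; p⊆p∪q; p⊂q⇒∣p∣<∣q∣; ∣p∣≤n)
open import Data.Vec using (_∷_; []; here; there; tabulate)
open import Data.Vec.Properties using (lookup∘tabulate; lookup⇒[]=; []=⇒lookup)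
open import Data.List using (List; []; _∷_; length; map)
open import Data.List.Properties using (length-map)
open import Data.List.Membership.Propositional using () renaming (_∈_ to _∈ₗ_; _∉_ to _∉ₗ_)
open import Data.List.Membership.Propositional.Properties using (∈-map⁻)
import Data.List.Membership.DecPropositional as DecMembership
open import Data.List.Relation.Unary.All as All using (All; []; _∷_)
open import Data.List.Relation.Unary.All.Properties as All using ()
open import Data.List.Relation.Unary.Unique.Propositional using (Unique)
open import Data.List.Relation.Unary.AllPairs using ([]; _∷_)
open import Data.List.Relation.Unary.Unique.Propositional.Properties as Unique using ()
open import Data.Product using (∃; _×_; _,_; proj₁)
open import Data.Sum using (_⊎_; inj₁; inj₂)
open import Data.Empty using (⊥-elim)
open import Relation.Nullary using (¬_; Dec; yes; no; does)
open import Relation.Nullary.Decidable using (_×-dec_; ¬?; _→-dec_; dec-true)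
open import Relation.Unary using (Decidable)
open import Relation.Binary.PropositionalEquality using (_≡_; refl; trans; cong; subst) renaming (sym to ≡-sym)

_∈ₗ?_ : ∀ {n} (x : Fin n) (xs : List (Fin n)) → Dec (x ∈ₗ xs)
_∈ₗ?_ {n} = DecMembership._∈?_ (_≟ᶠ_ {n})

element-outside : ∀ {n} (X : Subset n) (Q : List (Fin n)) →
                  ¬ (∀ x → x ∈ X → x ∈ₗ Q) → ∃ λ r → r ∈ X × r ∉ₗ Q
element-outside {n} X Q X⊈Q
  with ¬∀⟶∃¬ n (λ x → x ∈ X → x ∈ₗ Q) (λ x → (x ∈? X) →-dec (x ∈ₗ? Q)) X⊈Q
... | r , ¬[r∈X⇒r∈Q] with r ∈? X
... | yes r∈X = r , r∈X , (λ r∈Q → ¬[r∈X⇒r∈Q] (λ _ → r∈Q))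
... | no  r∉X = ⊥-elim (¬[r∈X⇒r∈Q] (λ r∈X → ⊥-elim (r∉X r∈X)))

⟦_⟧ : ∀ {n} {P : Fin n → Set} → Decidable P → Subset n
⟦ P? ⟧ = tabulate (λ x → does (P? x))

∈⟦⟧⁺ : ∀ {n} {P : Fin n → Set} (P? : Decidable P) {x} → P x → x ∈ ⟦ P? ⟧
∈⟦⟧⁺ P? {x} px = lookup⇒[]= x _ (trans (lookup∘tabulate _ x) (dec-true (P? x) px))

∈⟦⟧⁻ : ∀ {n} {P : Fin n → Set} (P? : Decidable P) {x} → x ∈ ⟦ P? ⟧ → P x
∈⟦⟧⁻ P? {x} x∈ with P? x | trans (≡-sym (lookup∘tabulate _ x)) ([]=⇒lookup x∈)
... | yes px | _ = px
... | no _   | ()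

-- Every subset is enumerated by a duplicate-free list of exactly ∣ p ∣ of
-- its elements; this turns the list-based bound AtMost into a size bound.
elements : ∀ {n} → Subset n → List (Fin n)
elements []            = []
elements (inside ∷ p)  = zero ∷ map suc (elements p)
elements (outside ∷ p) = map suc (elements p)

length-elements : ∀ {n} (p : Subset n) → length (elements p) ≡ ∣ p ∣
length-elements []            = refl
length-elements (inside ∷ p)  = cong suc (trans (length-map suc (elements p)) (length-elements p))
length-elements (outside ∷ p) = trans (length-map suc (elements p)) (length-elements p)

elements-unique : ∀ {n} (p : Subset n) → Unique (elements p)
elements-unique []            = []
elements-unique (inside ∷ p)  =
  All.tabulate zero∉ ∷ Unique.map⁺ suc-injective (elements-unique p)
  where
  zero∉ : ∀ {y} → y ∈ₗ map suc (elements p) → ¬ zero ≡ y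
  zero∉ y∈ refl with ∈-map⁻ suc y∈
  ... | _ , _ , ()
elements-unique (outside ∷ p) = Unique.map⁺ suc-injective (elements-unique p)

elements-sound : ∀ {n} (p : Subset n) → All (_∈ p) (elements p)
elements-sound []            = []
elements-sound (inside ∷ p)  = here ∷ All.map⁺ (All.map there (elements-sound p))
elements-sound (outside ∷ p) = All.map⁺ (All.map there (elements-sound p))

module _ {n : ℕ} (G : Graph n) where

  atMost-mono : ∀ {k} {P R : Fin n → Set} → (∀ {v} → R v → P v) →
                AtMost G k P → AtMost G k R
  atMost-mono R⇒P bound xs uniq all = bound xs uniq (All.map R⇒P all)

  atMost⇒size : ∀ {k} {P : Fin n → Set} (S : Subset n) → (∀ {v} → v ∈ S → P v) →
                AtMost G k P → ∣ S ∣ ≤ k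
  atMost⇒size S S⇒P bound = subst (_≤ _) (length-elements S)
    (bound (elements S) (elements-unique S) (All.map S⇒P (elements-sound S)))

  conn-head : ∀ {F : Fin n → Set} {u v} → Conn G F u v → ¬ F u
  conn-head (here ¬Fu)     = ¬Fu
  conn-head (step ¬Fu _ _) = ¬Fu

  conn-last : ∀ {F : Fin n → Set} {u v} → Conn G F u v → ¬ F v
  conn-last (here ¬Fv)   = ¬Fv
  conn-last (step _ _ c) = conn-last c

  conn-snoc : ∀ {F : Fin n → Set} {u v w} → Conn G F u v → Adj G v w → ¬ F w → Conn G F u w
  conn-snoc (here ¬Fv)       vw ¬Fw = step ¬Fv vw (here ¬Fw)
  conn-snoc (step ¬Fu uu' c) vw ¬Fw = step ¬Fu uu' (conn-snoc c vw ¬Fw)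

  ClosedOutside : (Fin n → Set) → Subset n → Set
  ClosedOutside B K = ∀ {v w} → v ∈ K → Adj G v w → ¬ B w → w ∈ K

  trapped : ∀ {B : Fin n → Set} {K : Subset n} → ClosedOutside B K →
            ∀ {u v} → Conn G B u v → u ∈ K → v ∈ K
  trapped closed (here _)      u∈K = u∈K
  trapped closed (step _ uw c) u∈K = trapped closed c (closed u∈K uw (conn-head c))

  record Component (F : Fin n → Set) (r : Fin n) : Set where
    field
      members : Subset n
      reached : ∀ {v} → v ∈ members → Conn G F r v
      closed  : ClosedOutside F members
      root    : r ∈ members

  -- For decidable F the component exists: start from {r} and repeatedly add a
  -- vertex of G - F adjacent to the current set, until no such edge exists.
  module _ {F : Fin n → Set} (F? : Decidable F) {r : Fin n} where

    Reached : Subset n → Set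
    Reached R = ∀ {v} → v ∈ R → Conn G F r v

    Exit : Subset n → Set
    Exit R = ∃ λ v → ∃ λ w → v ∈ R × Adj G v w × ¬ F w × w ∉ R

    exit? : ∀ R → Dec (Exit R)
    exit? R = any? λ v → any? λ w →
      (v ∈? R) ×-dec adj? G v w ×-dec ¬? (F? w) ×-dec ¬? (w ∈? R)

    noExit⇒closed : ∀ {R} → ¬ Exit R → ClosedOutside F R
    noExit⇒closed {R} noExit {v} {w} v∈R vw ¬Fw with w ∈? R
    ... | yes w∈R = w∈R
    ... | no  w∉R = ⊥-elim (noExit (v , w , v∈R , vw , ¬Fw , w∉R))

    -- Saturation, with fuel f bounding the number of vertices still missing.
    saturate : (f : ℕ) (R : Subset n) → Reached R → r ∈ R → n < f + ∣ R ∣ → Component F r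
    saturate zero R _ _ n<∣R∣ = ⊥-elim (<⇒≱ n<∣R∣ (∣p∣≤n R))
    saturate (suc f) R reachedR r∈R n<f+∣R∣ with exit? R
    ... | no noExit = record
      { members = R ; reached = reachedR ; closed = noExit⇒closed noExit ; root = r∈R }
    ... | yes (v , w , v∈R , vw , ¬Fw , w∉R) =
      saturate f R' reachedR' (x∈p∪q⁺ (inj₁ r∈R)) n<f+∣R'∣
      where
      R' : Subset n
      R' = R ∪ ⁅ w ⁆

      reachedR' : Reached R'
      reachedR' {u} u∈R' with x∈p∪q⁻ R ⁅ w ⁆ u∈R'
      ... | inj₁ u∈R = reachedR u∈R
      ... | inj₂ u∈w with x∈⁅y⁆⇒x≡y w u∈w
      ... | refl = conn-snoc (reachedR v∈R) vw ¬Fw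

      R⊂R' : R ⊂ R'
      R⊂R' = p⊆p∪q ⁅ w ⁆ , w , x∈p∪q⁺ (inj₂ (x∈⁅x⁆ w)) , w∉R

      n<f+∣R'∣ : n < f + ∣ R' ∣
      n<f+∣R'∣ = ≤-trans n<f+∣R∣
        (subst (_≤ f + ∣ R' ∣) (+-suc f ∣ R ∣) (+-monoʳ-≤ f (p⊂q⇒∣p∣<∣q∣ R⊂R')))

    component : ¬ F r → Component F r
    component ¬Fr = saturate (suc n) ⁅ r ⁆ reached₀ (x∈⁅x⁆ r) (s≤s (m≤m+n n _))
      where
      reached₀ : Reached ⁅ r ⁆
      reached₀ v∈r with x∈⁅y⁆⇒x≡y r v∈r
      ... | refl = here ¬Fr

  module Bridge (Q : List (Fin n)) {r : Fin n} (r∉Q : r ∉ₗ Q) where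

    K : Component (_∈ₗ Q) r
    K = component (_∈ₗ? Q) r∉Q

    open Component K

    -- Attachments, in the decidable form "adjacent to a member of K".
    AttachedToK : Fin n → Set
    AttachedToK v = v ∈ₗ Q × ∃ λ w → w ∈ members × Adj G v w

    attachedToK? : Decidable AttachedToK
    attachedToK? v = (v ∈ₗ? Q) ×-dec any? (λ w → (w ∈? members) ×-dec adj? G v w)

    attachedToK⇒attachment : ∀ {v} → AttachedToK v → Attachment G Q r v
    attachedToK⇒attachment (v∈Q , w , w∈K , vw) = v∈Q , w , reached w∈K , vw

    A : Subset n
    A = ⟦ attachedToK? ⟧

    ∣A∣≤3 : AtMost G 3 (Attachment G Q r) → ∣ A ∣ ≤ 3
    ∣A∣≤3 = atMost⇒size A (λ v∈A → attachedToK⇒attachment (∈⟦⟧⁻ attachedToK? v∈A))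

    -- A vertex of G - A adjacent to K is off Q, hence in K.
    K-closedOutside-A : ClosedOutside (_∈ A) members
    K-closedOutside-A {v} {w} v∈K vw w∉A with w ∈ₗ? Q
    ... | yes w∈Q = ⊥-elim (w∉A (∈⟦⟧⁺ attachedToK? (w∈Q , v , v∈K , sym G vw)))
    ... | no  w∉Q = closed v∈K vw w∉Q

    inBridge-or-separated : ∀ x → InBridge G Q r x ⊎ (x ∉ A × ¬ Conn G (_∈ A) r x)
    inBridge-or-separated x with x ∈? members | attachedToK? x
    ... | yes x∈K | _      = inj₁ (inj₁ (reached x∈K))
    ... | no  _   | yes at = inj₁ (inj₂ (attachedToK⇒attachment at))
    ... | no  x∉K | no ¬at =
      inj₂ ((λ x∈A → ¬at (∈⟦⟧⁻ attachedToK? x∈A)) ,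
            (λ c → x∉K (trapped K-closedOutside-A c root)))

    r∉A : r ∉ A
    r∉A r∈A = r∉Q (proj₁ (∈⟦⟧⁻ attachedToK? r∈A))

    bridge∩Q⇒attachment : ∀ {v} → InBridge G Q r v → v ∈ₗ Q → Attachment G Q r v
    bridge∩Q⇒attachment (inj₁ c)   v∈Q = ⊥-elim (conn-last c v∈Q)
    bridge∩Q⇒attachment (inj₂ att) _   = att

lemma7 : ∀ {n} (G : Graph n) (X : Subset n) (Q : List (Fin n)) →
    TwoConnected G →
    (∃ λ k → IsKappa G X k × 4 ≤ k) →
    IsTuttePath G Q →
    ¬ (∀ x → x ∈ X → x ∈ₗ Q) →
    (∃ λ r → r ∉ₗ Q × (∀ x → x ∈ X → InBridge G Q r x))
    × AtMost G 3 (λ v → v ∈ₗ Q × v ∈ X)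
lemma7 G X Q _ (k , ((_ , separators≥k) , _) , 4≤k) (_ , tutte) X⊈Q
  with element-outside X Q X⊈Q
... | r , r∈X , r∉Q = (r , r∉Q , X⊆bridge) , atMost-mono G X∩Q⇒attachment (tutte r r∉Q)
  where
  open Bridge G Q r∉Q

  -- Otherwise the at most 3 attachments would form a small X-separator.
  X⊆bridge : ∀ x → x ∈ X → InBridge G Q r x
  X⊆bridge x x∈X with inBridge-or-separated x
  ... | inj₁ x∈B          = x∈B
  ... | inj₂ (x∉A , ¬r~x) =
    ⊥-elim (<⇒≱ (≤-trans 4≤k (separators≥k A (r , x , r∈X , x∈X , r∉A , x∉A , ¬r~x)))
                (∣A∣≤3 (tutte r r∉Q)))

  X∩Q⇒attachment : ∀ {v} → v ∈ₗ Q × v ∈ X → Attachment G Q r v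
  X∩Q⇒attachment (v∈Q , v∈X) = bridge∩Q⇒attachment (X⊆bridge _ v∈X) v∈Q
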